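{- Let $T\subseteq[n]$ be a nonempty $k$-element set with block decomposition $T=T_1\cdots T_\ell$, let $M=\langle T\rangle$, and let $C=\{c_0<c_1<\dots<c_m\}$ be a circuit of $M$. If $C$ is a loop (i.e. $C=\{c_0\}$), then $c_0$ is strictly larger than the last element of $T_\ell$. Otherwise, there exists an index $1\le i\le\ell$ such that: - $|C|=|T_i|+|T_{i+1}|+\dots+|T_\ell|+1$; - $c_1c_2\cdots c_m\prec T_iT_{i+1}\cdots T_\ell$ (comparing these two increasing words of length $m$ component-wise); - if $i\neq 1$, then $c_0$ is strictly larger than the last element of $T_{i-1}$.
   Context: For increasing words $S=s_1\cdots s_m$ and $U=u_1\cdots u_m$ of the same length, $S\prec U$ means $s_j\le u_j$ for all $j$. For $T\in\binom{[n]}{k}$, $\langle T\rangle$ denotes the matroid on $[n]$ whose bases are the $k$-subsets $S$ with $S\prec T$. Blocks: a nonempty $T\subseteq[n]$, written as an increasing word, decomposes uniquely as a concatenation $T=T_1\cdots T_\ell$ of inclusion-maximal runs of consecutive integers; $T_i$ is the $i$-th block. -}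

module Defs where

open import Data.Nat using (ℕ; suc; _≤_; _<_; _≡ᵇ_)
open import Data.Bool using (if_then_else_)
open import Data.List using (List; []; _∷_; [_]; length)
open import Data.List.Relation.Unary.All using (All)
open import Data.List.Relation.Unary.Linked using (Linked)
open import Data.List.Relation.Binary.Pointwise using (Pointwise)
open import Data.List.Membership.Propositional using (_∈_)
open import Data.Product using (Σ; _×_)
open import Relation.Nullary using (¬_)
open import Relation.Binary.PropositionalEquality using (_≡_)

-- A subset of [n] = {1,…,n}, represented canonically as its strictly
-- increasing word (list of its elements in increasing order).
IsSubsetOf : ℕ → List ℕ → Set
IsSubsetOf n S = Linked _<_ S × All (λ x → 1 ≤ x × x ≤ n) S

_≺_ : List ℕ → List ℕ → Set
S ≺ U = Pointwise _≤_ S U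

_⊆ˢ_ : List ℕ → List ℕ → Set
A ⊆ˢ B = All (_∈ B) A

-- Bases of the matroid ⟨T⟩ on [n]: k-subsets S of [n] with S ≺ T (k = |T|;
-- S ≺ T forces |S| = |T|).
IsBasis : ℕ → List ℕ → List ℕ → Set
IsBasis n T S = IsSubsetOf n S × length S ≡ length T × S ≺ T

Independent : ℕ → List ℕ → List ℕ → Set
Independent n T I = IsSubsetOf n I × Σ (List ℕ) (λ B → IsBasis n T B × I ⊆ˢ B)

IsCircuit : ℕ → List ℕ → List ℕ → Set
IsCircuit n T C =
  IsSubsetOf n C × ¬ Independent n T C ×
  ((D : List ℕ) → IsSubsetOf n D → D ⊆ˢ C → ¬ (C ⊆ˢ D) → Independent n T D)

-- Block decomposition of an increasing word into inclusion-maximal runs of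
-- consecutive integers, T = T₁ ⋯ T_ℓ (blocks T = T₁ ∷ … ∷ T_ℓ ∷ []).
private
  addToBlocks : ℕ → List (List ℕ) → List (List ℕ)
  addToBlocks x [] = [ x ] ∷ []
  addToBlocks x ([] ∷ bs) = [ x ] ∷ [] ∷ bs
  addToBlocks x ((y ∷ b) ∷ bs) =
    if suc x ≡ᵇ y then (x ∷ y ∷ b) ∷ bs else [ x ] ∷ (y ∷ b) ∷ bs

blocks : List ℕ → List (List ℕ)
blocks [] = []
blocks (x ∷ xs) = addToBlocks x (blocks xs)

{-# OPTIONS --safe #-}
-- The independent sets of ⟨T⟩ are exactly the increasing words lying componentwise
-- below a suffix of T.  Deleting the least element c₀ of a circuit C leaves an
-- independent set, so c₁⋯cₘ ≺ U for a factorisation T = AU, and c₀ exceeds the last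
-- letter a of A, since otherwise C ≺ aU would be independent.  Then a < c₀ < c₁ ≤ head U,
-- so a + 1 ≠ head U and the cut between A and U is a block boundary: U = Tᵢ⋯T_ℓ.
-- For a loop, U is empty and A = T.
module Submission where

open import Defs
open import Data.Nat using (ℕ; suc; _<_; _≤_; _≡ᵇ_; z<s)
open import Data.Nat.Properties
  using (≤-refl; ≤-trans; <-trans; ≤-<-trans; <-≤-trans; <⇒≤; <-irrefl; <⇒≢; ≰⇒>; _≤?_;
         n<1+n; m≤n⇒m<n∨m≡n; m<m+n; ≡ᵇ⇒≡)
open import Data.Bool using (true; false)
open import Data.List using (List; []; _∷_; length; concat; drop; take; last; _++_)
open import Data.List.Properties using (length-++; ++-identityʳ)
open import Data.List.Membership.Propositional using (_∈_)
open import Data.List.Relation.Unary.Any using (here; there)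
open import Data.List.Relation.Unary.All as All using (All; []; _∷_)
import Data.List.Relation.Unary.AllPairs as AllPairs
open import Data.List.Relation.Unary.Linked as Linked using (Linked; [-]; _∷_; tail)
open import Data.List.Relation.Unary.Linked.Properties using (Linked⇒AllPairs)
open import Data.List.Relation.Binary.Pointwise using ([]; _∷_; Pointwise-length)
open import Data.List.Relation.Binary.Suffix.Heterogeneous as Suffix
  using (Suffix; here; there; toView) renaming (_++_ to _++ᵛ_)
import Data.List.Relation.Binary.Suffix.Heterogeneous.Properties as Suffixₚ
open import Data.Maybe using (just)
open import Data.Product using (∃; ∃₂; ∃-syntax; _×_; _,_; proj₁; proj₂; uncurry)
open import Data.Sum using (inj₁; inj₂)
open import Function using (id; _∘_)
open import Relation.Nullary using (¬_; yes; no; contradiction)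
open import Relation.Binary.PropositionalEquality using (_≡_; _≢_; refl; sym; trans; cong; subst)

[]-suffix : ∀ {a b r} {A : Set a} {B : Set b} {R : A → B → Set r} ys → Suffix R [] ys
[]-suffix []       = here []
[]-suffix (_ ∷ ys) = there ([]-suffix ys)

⊆ˢ-refl : ∀ {xs : List ℕ} → xs ⊆ˢ xs
⊆ˢ-refl = All.tabulate id

increasing⇒head< : ∀ {x xs} → Linked _<_ (x ∷ xs) → All (x <_) xs
increasing⇒head< = AllPairs.head ∘ Linked⇒AllPairs <-trans

lower-head : ∀ {x y ys} → x ≤ y → Linked _<_ (y ∷ ys) → Linked _<_ (x ∷ ys)
lower-head _   [-]          = [-]
lower-head x≤y (y<z ∷ z∷zs↑) = ≤-<-trans x≤y y<z ∷ z∷zs↑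

∈-∷⁻ : ∀ {b x : ℕ} {B} → b < x → x ∈ b ∷ B → x ∈ B
∈-∷⁻ b<b (here refl) = contradiction b<b (<-irrefl refl)
∈-∷⁻ _   (there x∈B) = x∈B

⊆ˢ-∷⁻ : ∀ {b X B} → All (b <_) X → X ⊆ˢ (b ∷ B) → X ⊆ˢ B
⊆ˢ-∷⁻ b<X X⊆b∷B = All.zipWith (uncurry ∈-∷⁻) (b<X , X⊆b∷B)

∷-suffix : ∀ {x b I B} → x ≤ b → Linked _<_ (b ∷ B) → Suffix _≤_ I B →
           Suffix _≤_ (x ∷ I) (b ∷ B)
∷-suffix x≤b _             (here I≺B)  = here (x≤b ∷ I≺B)
∷-suffix x≤b (b<b′ ∷ b′∷B↑) (there suf) = there (∷-suffix (≤-trans x≤b (<⇒≤ b<b′)) b′∷B↑ suf)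

⊆ˢ⇒suffix : ∀ {I B} → Linked _<_ I → Linked _<_ B → I ⊆ˢ B → Suffix _≤_ I B
⊆ˢ⇒suffix {[]}    {B}     _  _  _ = []-suffix B
⊆ˢ⇒suffix {i ∷ I} {i ∷ B} I↑ B↑ (here refl ∷ I⊆) =
  ∷-suffix ≤-refl B↑ (⊆ˢ⇒suffix (tail I↑) (tail B↑) (⊆ˢ-∷⁻ (increasing⇒head< I↑) I⊆))
⊆ˢ⇒suffix {i ∷ I} {b ∷ B} I↑ B↑ I⊆@(there i∈B ∷ _) =
  there (⊆ˢ⇒suffix I↑ (tail B↑) (⊆ˢ-∷⁻ (b<i ∷ All.map (<-trans b<i) (increasing⇒head< I↑)) I⊆))
  where
  b<i : b < i
  b<i = All.lookup (increasing⇒head< B↑) i∈B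

≤last⇒suffix : ∀ A {a c I U} → last A ≡ just a → c ≤ a → I ≺ U → Suffix _≤_ (c ∷ I) (A ++ U)
≤last⇒suffix []          ()
≤last⇒suffix (_ ∷ [])    refl    c≤a I≺U = here (c≤a ∷ I≺U)
≤last⇒suffix (_ ∷ y ∷ A) last≡a c≤a I≺U = there (≤last⇒suffix (y ∷ A) last≡a c≤a I≺U)

independent⇒suffix : ∀ {n T I} → Independent n T I → Suffix _≤_ I T
independent⇒suffix ((I↑ , _) , B , ((B↑ , _) , _ , B≺T) , I⊆B) =
  Suffixₚ.trans ≤-trans (⊆ˢ⇒suffix I↑ B↑ I⊆B) (here B≺T)

-- Greedy completion: each position of T not used by I receives the least number
-- above the previously placed one.
suffix⇒⊆ˢ-≺ : ∀ {lo I T} → Linked _<_ (lo ∷ I) → Linked _<_ (lo ∷ T) → Suffix _≤_ I T →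
              ∃[ B ] Linked _<_ (lo ∷ B) × B ≺ T × I ⊆ˢ B
suffix⇒⊆ˢ-≺ lo∷I↑ _ (here I≺T) = _ , lo∷I↑ , I≺T , ⊆ˢ-refl
suffix⇒⊆ˢ-≺ {lo} {[]} _ (lo<t ∷ t∷T↑) (there suf)
  with B , B↑ , B≺T , _ ← suffix⇒⊆ˢ-≺ [-] (lower-head lo<t t∷T↑) suf
  = suc lo ∷ B , n<1+n lo ∷ B↑ , lo<t ∷ B≺T , []
suffix⇒⊆ˢ-≺ {lo} {i ∷ I} (lo<i ∷ i∷I↑) (lo<t ∷ t∷T↑) (there suf) with m≤n⇒m<n∨m≡n lo<i
... | inj₂ refl
  with B , B↑ , B≺T , I⊆B ← suffix⇒⊆ˢ-≺ i∷I↑ (lower-head lo<t t∷T↑) (Suffix.tail suf)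
  = suc lo ∷ B , n<1+n lo ∷ B↑ , lo<t ∷ B≺T , here refl ∷ All.map there I⊆B
... | inj₁ 1+lo<i
  with B , B↑ , B≺T , i∷I⊆B ← suffix⇒⊆ˢ-≺ (1+lo<i ∷ i∷I↑) (lower-head lo<t t∷T↑) suf
  = suc lo ∷ B , n<1+n lo ∷ B↑ , lo<t ∷ B≺T , All.map there i∷I⊆B

positive⇒0∷-increasing : ∀ {n I} → IsSubsetOf n I → Linked _<_ (0 ∷ I)
positive⇒0∷-increasing (_  , [])             = [-]
positive⇒0∷-increasing (I↑ , (1≤i , _) ∷ _) = 1≤i ∷ I↑

≺-bounded : ∀ {n B T} → B ≺ T → All (_≤ n) T → All (_≤ n) B
≺-bounded []          []          = []
≺-bounded (b≤t ∷ B≺T) (t≤n ∷ T≤n) = ≤-trans b≤t t≤n ∷ ≺-bounded B≺T T≤n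

suffix⇒independent : ∀ {n T I} → IsSubsetOf n T → IsSubsetOf n I → Suffix _≤_ I T →
                     Independent n T I
suffix⇒independent {n} T⊆[n]@(_ , T∈[n]) I⊆[n] suf
  with B , 0∷B↑ , B≺T , I⊆B ←
         suffix⇒⊆ˢ-≺ (positive⇒0∷-increasing I⊆[n]) (positive⇒0∷-increasing T⊆[n]) suf
  = I⊆[n] , B , (B⊆[n] , Pointwise-length B≺T , B≺T) , I⊆B
  where
  B⊆[n] : IsSubsetOf n B
  B⊆[n] = tail 0∷B↑ , All.zip (increasing⇒head< 0∷B↑ , ≺-bounded B≺T (All.map proj₂ T∈[n]))

dependent⇒last<head : ∀ {n} A {U c I a} → IsSubsetOf n (A ++ U) → IsSubsetOf n (c ∷ I) →
                      ¬ Independent n (A ++ U) (c ∷ I) → I ≺ U → last A ≡ just a → a < c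
dependent⇒last<head A {c = c} {a = a} T⊆[n] cI⊆[n] dependent I≺U last≡a with c ≤? a
... | yes c≤a =
  contradiction (suffix⇒independent T⊆[n] cI⊆[n] (≤last⇒suffix A last≡a c≤a I≺U)) dependent
... | no  c≰a = ≰⇒> c≰a

circuit-tail-independent : ∀ {n T c₀ I} → IsCircuit n T (c₀ ∷ I) → Independent n T I
circuit-tail-independent {c₀ = c₀} {I} ((c₀∷I↑ , c₀∷I∈[n]) , _ , minimal) =
  minimal I (tail c₀∷I↑ , All.tail c₀∷I∈[n]) (All.map there ⊆ˢ-refl) c₀∉I
  where
  c₀∉I : ¬ (c₀ ∷ I) ⊆ˢ I
  c₀∉I (c₀∈I ∷ _) = <-irrefl refl (All.lookup (increasing⇒head< c₀∷I↑) c₀∈I)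

circuit-split : ∀ {n T c₀ I} → IsSubsetOf n T → IsCircuit n T (c₀ ∷ I) →
                ∃₂ λ A U → T ≡ A ++ U × I ≺ U × (∀ {a} → last A ≡ just a → a < c₀)
circuit-split T⊆[n] circuit@(c₀I⊆[n] , dependent , _)
  with A ++ᵛ I≺U ← toView (independent⇒suffix (circuit-tail-independent circuit))
  = A , _ , refl , I≺U , dependent⇒last<head A T⊆[n] c₀I⊆[n] dependent I≺U

concat-blocks : ∀ xs → concat (blocks xs) ≡ xs
concat-blocks []       = refl
concat-blocks (x ∷ xs) with blocks xs | concat-blocks xs
... | []           | refl = refl
... | [] ∷ _       | ih   = cong (x ∷_) ih
... | (y ∷ _) ∷ _  | ih with suc x ≡ᵇ y
...   | true  = cong (x ∷_) ih
...   | false = cong (x ∷_) ih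

blocks-∷ : ∀ x xs → ∃₂ λ b bs → blocks (x ∷ xs) ≡ (x ∷ b) ∷ bs
blocks-∷ x xs with blocks xs
... | []           = [] , [] , refl
... | [] ∷ bs      = [] , [] ∷ bs , refl
... | (y ∷ b) ∷ bs with suc x ≡ᵇ y
...   | true  = y ∷ b , bs , refl
...   | false = [] , (y ∷ b) ∷ bs , refl

blocks-++ : ∀ A {u U} → (∀ {a} → last A ≡ just a → suc a ≢ u) →
            blocks (A ++ u ∷ U) ≡ blocks A ++ blocks (u ∷ U)
blocks-++ []      _ = refl
blocks-++ (x ∷ []) {u} {U} gap with blocks (u ∷ U) | blocks-∷ u U
... | _ | _ , _ , refl with suc x ≡ᵇ u | ≡ᵇ⇒≡ (suc x) u
...   | true  | 1+x≡u = contradiction (1+x≡u _) (gap refl)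
...   | false | _     = refl
blocks-++ (x ∷ y ∷ A) {u} {U} gap rewrite blocks-++ (y ∷ A) {u} {U} gap
  with blocks (y ∷ A) | blocks-∷ y A
... | _ | _ , _ , refl with suc x ≡ᵇ y
...   | true  = refl
...   | false = refl

take-length-++ : ∀ {a} {A : Set a} (xs ys : List A) → take (length xs) (xs ++ ys) ≡ xs
take-length-++ []       _  = refl
take-length-++ (x ∷ xs) ys = cong (x ∷_) (take-length-++ xs ys)

drop-length-++ : ∀ {a} {A : Set a} (xs ys : List A) → drop (length xs) (xs ++ ys) ≡ ys
drop-length-++ []       _  = refl
drop-length-++ (_ ∷ xs) ys = drop-length-++ xs ys

block-boundary : ∀ A u U → (∀ {a} → last A ≡ just a → suc a ≢ u) →
                 let bs = blocks (A ++ u ∷ U); j = length (blocks A) in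
                 j < length bs × concat (take j bs) ≡ A × concat (drop j bs) ≡ u ∷ U
block-boundary A u U gap rewrite blocks-++ A {u} {U} gap =
  j<ℓ ,
  trans (cong concat (take-length-++ (blocks A) _)) (concat-blocks A) ,
  trans (cong concat (drop-length-++ (blocks A) _)) (concat-blocks (u ∷ U))
  where
  j<ℓ : length (blocks A) < length (blocks A ++ blocks (u ∷ U))
  j<ℓ with _ , _ , u∷U-blocks ← blocks-∷ u U
    rewrite length-++ (blocks A) {blocks (u ∷ U)} | u∷U-blocks = m<m+n _ z<s

lemma11 : (n : ℕ) (T : List ℕ) → IsSubsetOf n T → T ≢ [] →
          (C : List ℕ) → IsCircuit n T C →
          ((c₀ : ℕ) → C ≡ c₀ ∷ [] → (x : ℕ) → last T ≡ just x → x < c₀)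
          ×
          ((c₀ c₁ : ℕ) (cs : List ℕ) → C ≡ c₀ ∷ c₁ ∷ cs →
           ∃ λ j → j < length (blocks T)
             × length C ≡ suc (length (concat (drop j (blocks T))))
             × (c₁ ∷ cs) ≺ concat (drop j (blocks T))
             × (j ≢ 0 → (x : ℕ) → last (concat (take j (blocks T))) ≡ just x → x < c₀))
lemma11 n T T⊆[n] _ C circuit@(C⊆[n] , _) = loop , non-loop
  where
  loop : (c₀ : ℕ) → C ≡ c₀ ∷ [] → (x : ℕ) → last T ≡ just x → x < c₀
  loop c₀ refl x last≡x with A , _ , refl , [] , last<c₀ ← circuit-split T⊆[n] circuit
    = last<c₀ (trans (cong last (sym (++-identityʳ A))) last≡x)

  non-loop : (c₀ c₁ : ℕ) (cs : List ℕ) → C ≡ c₀ ∷ c₁ ∷ cs →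
             ∃ λ j → j < length (blocks T)
               × length C ≡ suc (length (concat (drop j (blocks T))))
               × (c₁ ∷ cs) ≺ concat (drop j (blocks T))
               × (j ≢ 0 → (x : ℕ) → last (concat (take j (blocks T))) ≡ just x → x < c₀)
  non-loop c₀ c₁ cs refl
    with A , u ∷ U , refl , I≺U@(c₁≤u ∷ _) , last<c₀ ← circuit-split T⊆[n] circuit
    with j<ℓ , take≡A , drop≡U ← block-boundary A u U (λ last≡a →
           <⇒≢ (≤-<-trans (last<c₀ last≡a) (<-≤-trans (Linked.head (proj₁ C⊆[n])) c₁≤u)))
    = length (blocks A) , j<ℓ ,
      cong suc (trans (Pointwise-length I≺U) (cong length (sym drop≡U))) ,
      subst ((c₁ ∷ cs) ≺_) (sym drop≡U) I≺U ,
      λ _ _ last≡x → last<c₀ (trans (cong last (sym take≡A)) last≡x)
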